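{- Let $p_1,p_3,p_4$ be distinct primes and $\hat K_1,\hat K_2,\hat K$ as in the context. Then: (1) $\hat K_1$ and $\hat K_2$ are each closed under (external) direct sums. (2) $\hat K$ is not closed under direct sums.
   Context: For an abelian group $G$ and prime $p$, $p^\omega G:=\bigcap_{n\geq 0}p^nG$. $\hat K_1$ is the class of torsion-free abelian groups $G$ with $G=p_1^\omega G$ and $p^\omega G=0$ for all primes $p\neq p_1$. $\hat K_2$ is the class of torsion-free abelian groups $G$ such that (a) for every $g\in p_1^\omega G$ there is at most one $z\in p_3^\omega G$ with $g+z\in p_4^\omega G$, and (b) for every $g\in p_1^\omega G$ there exist an integer $k>0$ and $z\in p_3^\omega G$ with $kg+z\in p_4^\omega G$. $\hat K=\hat K_1\cup\hat K_2$. -}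

module Defs where

open import Level using (Level; _⊔_)
open import Data.Nat using (ℕ; suc; _^_)
open import Data.Nat.Primality using (Prime)
open import Data.Product using (Σ; _×_; _,_; proj₁; proj₂)
open import Data.Sum using (_⊎_)
open import Data.List using (List; _++_)
open import Data.List.Membership.Propositional using (_∈_)
open import Data.List.Membership.Propositional.Properties using (∈-++⁺ˡ; ∈-++⁺ʳ)
open import Relation.Nullary using (¬_)
open import Relation.Binary.PropositionalEquality using (_≡_)
open import Algebra.Bundles using (AbelianGroup)
import Algebra.Definitions.RawMonoid as RM
import Algebra.Properties.Group as PG

private
  variable
    c ℓ : Level

module _ (G : AbelianGroup c ℓ) where
  open AbelianGroup G

  _·_ : ℕ → Carrier → Carrier
  n · x = RM._×_ rawMonoid n x

  TorsionFree : Set (c ⊔ ℓ)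
  TorsionFree = ∀ (n : ℕ) (x : Carrier) → suc n · x ≈ ε → x ≈ ε

  InPow : ℕ → ℕ → Carrier → Set (c ⊔ ℓ)
  InPow p n x = Σ Carrier λ y → (p ^ n) · y ≈ x

  InPω : ℕ → Carrier → Set (c ⊔ ℓ)
  InPω p x = ∀ (n : ℕ) → InPow p n x

  K̂₁ : ℕ → Set (c ⊔ ℓ)
  K̂₁ p₁ = TorsionFree
        × (∀ (x : Carrier) → InPω p₁ x)
        × (∀ (p : ℕ) → Prime p → ¬ (p ≡ p₁) → ∀ (x : Carrier) → InPω p x → x ≈ ε)

  K̂₂ : ℕ → ℕ → ℕ → Set (c ⊔ ℓ)
  K̂₂ p₁ p₃ p₄ = TorsionFree
    × (∀ (g : Carrier) → InPω p₁ g →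
         ∀ (z z′ : Carrier) → InPω p₃ z → InPω p₃ z′ →
         InPω p₄ (g ∙ z) → InPω p₄ (g ∙ z′) → z ≈ z′)
    × (∀ (g : Carrier) → InPω p₁ g →
         Σ ℕ λ k → Σ Carrier λ z → InPω p₃ z × InPω p₄ ((suc k · g) ∙ z))

  K̂ : ℕ → ℕ → ℕ → Set (c ⊔ ℓ)
  K̂ p₁ p₃ p₄ = K̂₁ p₁ ⊎ K̂₂ p₁ p₃ p₄

-- External direct sum of a family of abelian groups indexed by a type I:
-- finitely supported sections, with pointwise operations and equality.

module _ {i : Level} (I : Set i) (G : I → AbelianGroup c ℓ) where
  private
    module G (j : I) = AbelianGroup (G j)

  DCarrier : Set (i ⊔ c ⊔ ℓ)
  DCarrier = Σ ((j : I) → G.Carrier j) λ f →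
               Σ (List I) λ L → ∀ (j : I) → ¬ (j ∈ L) → G._≈_ j (f j) (G.ε j)

  _≈D_ : DCarrier → DCarrier → Set (i ⊔ ℓ)
  x ≈D y = ∀ (j : I) → G._≈_ j (proj₁ x j) (proj₁ y j)

  _+D_ : DCarrier → DCarrier → DCarrier
  (f , L , sf) +D (g , M , sg) =
    (λ j → G._∙_ j (f j) (g j)) , (L ++ M) ,
    λ j j∉ → G.trans j (G.∙-cong j (sf j (λ j∈ → j∉ (∈-++⁺ˡ j∈)))
                                   (sg j (λ j∈ → j∉ (∈-++⁺ʳ L j∈))))
                       (G.identityˡ j (G.ε j))

  0D : DCarrier
  0D = (λ j → G.ε j) , Data.List.[] , λ j _ → G.refl j

  -D_ : DCarrier → DCarrier
  -D (f , L , sf) = (λ j → G._⁻¹ j (f j)) , L ,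
    λ j j∉ → G.trans j (G.⁻¹-cong j (sf j j∉)) (PG.ε⁻¹≈ε (G.group j))

  ⨁ : AbelianGroup (i ⊔ c ⊔ ℓ) (i ⊔ ℓ)
  ⨁ = record
    { Carrier = DCarrier
    ; _≈_ = _≈D_
    ; _∙_ = _+D_
    ; ε = 0D
    ; _⁻¹ = -D_
    ; isAbelianGroup = record
      { isGroup = record
        { isMonoid = record
          { isSemigroup = record
            { isMagma = record
              { isEquivalence = record
                { refl = λ j → G.refl j
                ; sym = λ p j → G.sym j (p j)
                ; trans = λ p q j → G.trans j (p j) (q j)
                }
              ; ∙-cong = λ p q j → G.∙-cong j (p j) (q j)
              }
            ; assoc = λ x y z j → G.assoc j (proj₁ x j) (proj₁ y j) (proj₁ z j)
            }
          ; identity = (λ x j → G.identityˡ j (proj₁ x j))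
                     , (λ x j → G.identityʳ j (proj₁ x j))
          }
        ; inverse = (λ x j → G.inverseˡ j (proj₁ x j))
                  , (λ x j → G.inverseʳ j (proj₁ x j))
        ; ⁻¹-cong = λ p j → G.⁻¹-cong j (p j)
        }
      ; comm = λ x y j → G.comm j (proj₁ x j) (proj₁ y j)
      }
    }

{-# OPTIONS --safe #-}
module Submission where

-- Torsion-freeness and membership in p^ω are both read off componentwise in a direct sum of
-- torsion-free groups. This gives (1) for K̂₁ and for condition (a) of K̂₂; for condition (b)
-- the multipliers k_j of the finitely many nonzero components are replaced by their product.
-- For (2), ℤ[1/p₁] ∈ K̂₁ and ℤ ∈ K̂₂, while in ℤ[1/p₁] ⊕ ℤ the element (0, 1) is not
-- p₁-divisible and (1, 0) ∈ p₁^ω has no multiple in p₃^ω + p₄^ω = 0.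

open import Defs hiding (_·_)
open import Level using (Level; 0ℓ; _⊔_)
open import Function.Base using (_∘_; _on_; id)
open import Data.Bool using (Bool; true; false)
open import Data.Empty using (⊥-elim)
open import Data.Nat as ℕ
  using (ℕ; zero; suc; pred; _^_; _<_; s≤s; z≤n; NonZero; NonTrivial)
open import Data.Nat.Properties
  using (*-comm; *-assoc; ^-distribˡ-+-*; m^n≢0; m<m*n; <⇒≱; suc-pred; module ≤-Reasoning)
open import Data.Nat.Divisibility
  using ( _∣_; _∣?_; divides; ∣-trans; ∣-reflexive; m∣m*n; *-monoʳ-∣; *-cancelˡ-∣
        ; 1∣_; ∣1⇒≡1; ∣⇒≤)
open import Data.Nat.ListAction using (product)
open import Data.Nat.ListAction.Properties using (∈⇒∣product; product≢0)
open import Data.Nat.Primality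
  using (Prime; euclidsLemma; prime⇒nonZero; prime⇒nonTrivial; prime⇒irreducible; ¬prime[1])
open import Data.Integer as ℤ using (ℤ; +_; ∣_∣)
import Data.Integer.Properties as ℤ
open import Data.Integer.Tactic.RingSolver using (solve-∀)
open import Data.Rational.Unnormalised.Base as ℚ
  using (ℚᵘ; mkℚᵘ; ↥_; ↧_; ↧ₙ_; _≃_; *≡*)
import Data.Rational.Unnormalised.Properties as ℚ
open import Data.Product using (Σ; _×_; _,_; proj₁; proj₂)
open import Data.Sum using (inj₁; inj₂)
open import Data.List using (List; []; _∷_; map)
open import Data.List.Relation.Unary.All using (universal)
open import Data.List.Relation.Unary.All.Properties using (map⁺)
open import Data.List.Relation.Unary.Any using (here; there)
open import Data.List.Membership.Propositional using (_∈_)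
open import Data.List.Membership.Propositional.Properties using (∈-map⁺)
open import Relation.Nullary using (¬_; Dec; yes; no)
import Relation.Binary.PropositionalEquality as ≡
open ≡ using (_≡_; _≢_; refl)
open import Algebra.Bundles using (AbelianGroup; RawGroup)
open import Algebra.Structures using (IsAbelianGroup)
open import Algebra.Morphism.Structures using (IsGroupMonomorphism)
import Algebra.Morphism.GroupMonomorphism as GroupMonomorphism
import Algebra.Properties.Monoid.Mult as MonoidMult
import Algebra.Properties.CommutativeMonoid.Mult as CommutativeMonoidMult
import Relation.Binary.Reasoning.Setoid as SetoidReasoning

module _ {p : ℕ} (p-prime : Prime p) where
  private instance
    p≢0 : NonZero p
    p≢0 = prime⇒nonZero p-prime

  ∤⇒∤^ : ∀ {n} → ¬ p ∣ n → ∀ e → ¬ p ∣ n ^ e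
  ∤⇒∤^ p∤n zero p∣1 = ¬prime[1] (≡.subst Prime (∣1⇒≡1 p∣1) p-prime)
  ∤⇒∤^ {n} p∤n (suc e) p∣n^[1+e] with euclidsLemma n (n ^ e) p-prime p∣n^[1+e]
  ... | inj₁ p∣n   = p∤n p∣n
  ... | inj₂ p∣n^e = ∤⇒∤^ p∤n e p∣n^e

  p^m∣a*n⇒p^m∣a : ∀ {n} → ¬ p ∣ n → ∀ m a → p ^ m ∣ a ℕ.* n → p ^ m ∣ a
  p^m∣a*n⇒p^m∣a p∤n zero a _ = 1∣ a
  p^m∣a*n⇒p^m∣a {n} p∤n (suc m) a p^[1+m]∣an
    with euclidsLemma a n p-prime (∣-trans (m∣m*n (p ^ m)) p^[1+m]∣an)
  ... | inj₂ p∣n = ⊥-elim (p∤n p∣n)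
  ... | inj₁ (divides b refl) = ∣-trans (*-monoʳ-∣ p p^m∣b) (∣-reflexive (*-comm p b))
    where
    p^m∣b : p ^ m ∣ b
    p^m∣b = p^m∣a*n⇒p^m∣a p∤n m b (*-cancelˡ-∣ p (∣-trans p^[1+m]∣an
              (∣-reflexive (≡.trans (≡.cong (ℕ._* n) (*-comm b p)) (*-assoc p b n)))))

n<m^n : ∀ m .{{_ : NonTrivial m}} n → n < m ^ n
n<m^n m zero = s≤s z≤n
n<m^n m (suc n) = begin-strict
  suc n        ≤⟨ n<m^n m n ⟩
  m ^ n        <⟨ m<m*n (m ^ n) m (ℕ.nonTrivial⇒n>1 m) ⟩
  m ^ n ℕ.* m  ≡⟨ *-comm (m ^ n) m ⟩
  m ^ suc n    ∎
  where
  open ≤-Reasoning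
  instance
    m^n≢0′ : NonZero (m ^ n)
    m^n≢0′ = m^n≢0 m n {{ℕ.nonTrivial⇒nonZero m}}

m^n∣n⇒n≡0 : ∀ m .{{_ : NonTrivial m}} n → m ^ n ∣ n → n ≡ 0
m^n∣n⇒n≡0 m zero    _     = refl
m^n∣n⇒n≡0 m (suc n) m^n∣n = ⊥-elim (<⇒≱ (n<m^n m (suc n)) (∣⇒≤ m^n∣n))

module _ {c ℓ : Level} (G : AbelianGroup c ℓ) where
  open AbelianGroup G
  open MonoidMult monoid using (×-homo-0; ×-congʳ; ×-congˡ; ×-assocˡ) renaming (_×_ to _·_)
  open CommutativeMonoidMult commutativeMonoid using (×-distrib-+)
  open SetoidReasoning setoid

  TrivialPω : ℕ → Set (c ⊔ ℓ)
  TrivialPω p = ∀ x → InPω G p x → x ≈ ε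

  Witness : ℕ → ℕ → ℕ → Carrier → Set (c ⊔ ℓ)
  Witness p₃ p₄ k g = Σ Carrier λ z → InPω G p₃ z × InPω G p₄ (k · g ∙ z)

  ·-zeroʳ : ∀ n → n · ε ≈ ε
  ·-zeroʳ zero    = ×-homo-0 ε
  ·-zeroʳ (suc n) = trans (identityˡ (n · ε)) (·-zeroʳ n)

  ·≈ε⇒≈ε : TorsionFree G → ∀ k .{{_ : NonZero k}} {x} → k · x ≈ ε → x ≈ ε
  ·≈ε⇒≈ε torsionFree (suc k) = torsionFree k _

  InPω-resp-≈ : ∀ {p x y} → x ≈ y → InPω G p x → InPω G p y
  InPω-resp-≈ x≈y x∈ n = proj₁ (x∈ n) , trans (proj₂ (x∈ n)) x≈y

  InPω-ε : ∀ {p} → InPω G p ε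
  InPω-ε {p} n = ε , ·-zeroʳ (p ^ n)

  InPω-· : ∀ {p x} m → InPω G p x → InPω G p (m · x)
  InPω-· {p} {x} m x∈ n = m · y , (begin
    (p ^ n) · (m · y)    ≈⟨ ×-assocˡ y (p ^ n) m ⟩
    (p ^ n ℕ.* m) · y    ≈⟨ ×-congˡ (*-comm (p ^ n) m) ⟩
    (m ℕ.* p ^ n) · y    ≈⟨ ×-assocˡ y m (p ^ n) ⟨
    m · ((p ^ n) · y)    ≈⟨ ×-congʳ m (proj₂ (x∈ n)) ⟩
    m · x                ∎)
    where y = proj₁ (x∈ n)

  Witness-* : ∀ {p₃ p₄ k g} m → Witness p₃ p₄ k g → Witness p₃ p₄ (m ℕ.* k) g
  Witness-* {k = k} {g} m (z , z∈ , kg∙z∈) =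
    m · z , InPω-· m z∈ , InPω-resp-≈ m[kg∙z]≈mkg∙mz (InPω-· m kg∙z∈)
    where
    m[kg∙z]≈mkg∙mz : m · (k · g ∙ z) ≈ (m ℕ.* k) · g ∙ m · z
    m[kg∙z]≈mkg∙mz = begin
      m · (k · g ∙ z)        ≈⟨ ×-distrib-+ (k · g) z m ⟩
      m · (k · g) ∙ m · z    ≈⟨ ∙-congʳ (×-assocˡ g m k) ⟩
      (m ℕ.* k) · g ∙ m · z  ∎

  Witness-ε : ∀ {p₃ p₄ k g} → g ≈ ε → Witness p₃ p₄ k g
  Witness-ε {k = k} {g} g≈ε = ε , InPω-ε , InPω-resp-≈ (sym kg∙ε≈ε) InPω-ε
    where
    kg∙ε≈ε : k · g ∙ ε ≈ ε
    kg∙ε≈ε = trans (identityʳ (k · g)) (trans (×-congʳ k g≈ε) (·-zeroʳ k))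

  K̂₂-witness-of-ε≈ε : ∀ {p₁ p₃ p₄ k g} → K̂₂ G p₁ p₃ p₄ → g ≈ ε →
                      (w : Witness p₃ p₄ k g) → proj₁ w ≈ ε
  K̂₂-witness-of-ε≈ε {k = k} (_ , unique , _) g≈ε (z , z∈ , kg∙z∈) =
    sym (unique ε InPω-ε ε z InPω-ε z∈ (InPω-resp-≈ (sym (identityˡ ε)) InPω-ε)
                (InPω-resp-≈ (∙-congʳ (trans (×-congʳ k g≈ε) (·-zeroʳ k))) kg∙z∈))

  trivialPω⇒K̂₂ : ∀ {p₁ p₃ p₄} → TorsionFree G → TrivialPω p₁ → TrivialPω p₄ → K̂₂ G p₁ p₃ p₄
  trivialPω⇒K̂₂ {p₁} {p₃} {p₄} torsionFree trivial₁ trivial₄ =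
    torsionFree , unique , λ g g∈ → 0 , Witness-ε {k = 1} (trivial₁ g g∈)
    where
    unique : ∀ g → InPω G p₁ g → ∀ z z′ → InPω G p₃ z → InPω G p₃ z′ →
             InPω G p₄ (g ∙ z) → InPω G p₄ (g ∙ z′) → z ≈ z′
    unique g g∈ z z′ _ _ g∙z∈ g∙z′∈ = trans (vanish z g∙z∈) (sym (vanish z′ g∙z′∈))
      where
      vanish : ∀ w → InPω G p₄ (g ∙ w) → w ≈ ε
      vanish w g∙w∈ =
        trivial₄ w (InPω-resp-≈ (trans (∙-congʳ (trivial₁ g g∈)) (identityˡ w)) g∙w∈)

  ¬K̂₂ : ∀ {p₁ p₃ p₄ g} → InPω G p₁ g → ¬ g ≈ ε → TrivialPω p₃ → TrivialPω p₄ →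
        ¬ K̂₂ G p₁ p₃ p₄
  ¬K̂₂ {g = g} g∈ g≉ε trivial₃ trivial₄ (torsionFree , _ , witness) with witness g g∈
  ... | k , z , z∈ , kg∙z∈ = g≉ε (torsionFree k g (begin
    suc k · g      ≈⟨ identityʳ (suc k · g) ⟨
    suc k · g ∙ ε  ≈⟨ ∙-congˡ (trivial₃ z z∈) ⟨
    suc k · g ∙ z  ≈⟨ trivial₄ _ kg∙z∈ ⟩
    ε              ∎))

module _ {i c ℓ : Level} {I : Set i} (G : I → AbelianGroup c ℓ) where
  private
    module G (j : I) where
      open AbelianGroup (G j) public
      open MonoidMult monoid public using () renaming (_×_ to _·_)
    module S where
      open AbelianGroup (⨁ I G) public
      open MonoidMult monoid public using () renaming (_×_ to _·_)

  proj-· : ∀ n x j → G._≈_ j (proj₁ (n S.· x) j) (G._·_ j n (proj₁ x j))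
  proj-· zero    x j = G.refl j
  proj-· (suc n) x j = G.∙-congˡ j (proj-· n x j)

  InPω-proj : ∀ {p x} → InPω (⨁ I G) p x → ∀ j → InPω (G j) p (proj₁ x j)
  InPω-proj {p} x∈ j n =
    proj₁ (proj₁ (x∈ n)) j ,
    G.trans j (G.sym j (proj-· (p ^ n) (proj₁ (x∈ n)) j)) (proj₂ (x∈ n) j)

  -- By torsion-freeness the p^n-th parts of the components vanish wherever x does.
  InPω-⨁ : ∀ {p x} .{{_ : NonZero p}} → (∀ j → TorsionFree (G j)) →
           (∀ j → InPω (G j) p (proj₁ x j)) → InPω (⨁ I G) p x
  InPω-⨁ {p} {f , L , f-supp} torsionFree x∈ n =
    (y , L , y-supp) , λ j → G.trans j (proj-· (p ^ n) _ j) (proj₂ (x∈ j n))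
    where
    y : ∀ j → G.Carrier j
    y j = proj₁ (x∈ j n)
    y-supp : ∀ j → ¬ j ∈ L → G._≈_ j (y j) (G.ε j)
    y-supp j j∉L = ·≈ε⇒≈ε (G j) (torsionFree j) (p ^ n) {{m^n≢0 p n}}
                     (G.trans j (proj₂ (x∈ j n)) (f-supp j j∉L))

  torsionFree-⨁ : (∀ j → TorsionFree (G j)) → TorsionFree (⨁ I G)
  torsionFree-⨁ torsionFree n x n·x≈ε j =
    torsionFree j n (proj₁ x j) (G.trans j (G.sym j (proj-· (suc n) x j)) (n·x≈ε j))

  trivialPω-⨁ : ∀ {p} → (∀ j → TrivialPω (G j) p) → TrivialPω (⨁ I G) p
  trivialPω-⨁ trivial x x∈ j = trivial j (proj₁ x j) (InPω-proj {x = x} x∈ j)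

  K̂₁-⨁ : ∀ {p₁} → Prime p₁ → (∀ j → K̂₁ (G j) p₁) → K̂₁ (⨁ I G) p₁
  K̂₁-⨁ p₁-prime K̂₁-G =
    torsionFree-⨁ torsionFree ,
    (λ x → InPω-⨁ {x = x} {{prime⇒nonZero p₁-prime}} torsionFree
             (λ j → proj₁ (proj₂ (K̂₁-G j)) (proj₁ x j))) ,
    λ p p-prime p≢p₁ → trivialPω-⨁ (λ j → proj₂ (proj₂ (K̂₁-G j)) p p-prime p≢p₁)
    where
    torsionFree : ∀ j → TorsionFree (G j)
    torsionFree j = proj₁ (K̂₁-G j)

  Witness-⨁ : ∀ {p₃ p₄ k g} .{{_ : NonZero p₃}} .{{_ : NonZero p₄}} →
              (∀ j → TorsionFree (G j)) →
              (L : List I) (w : ∀ j → Witness (G j) p₃ p₄ k (proj₁ g j)) →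
              (∀ j → ¬ j ∈ L → G._≈_ j (proj₁ (w j)) (G.ε j)) →
              Witness (⨁ I G) p₃ p₄ k g
  Witness-⨁ {k = k} {g} torsionFree L w w-supp =
    z , InPω-⨁ {x = z} torsionFree (λ j → proj₁ (proj₂ (w j))) ,
    InPω-⨁ {x = k S.· g S.∙ z} torsionFree
      (λ j → InPω-resp-≈ (G j) (G.∙-congʳ j (G.sym j (proj-· k g j))) (proj₂ (proj₂ (w j))))
    where
    z : S.Carrier
    z = (λ j → proj₁ (w j)) , L , w-supp

  module _ {p₁ p₃ p₄} (p₃-prime : Prime p₃) (p₄-prime : Prime p₄)
           (K̂₂-G : ∀ j → K̂₂ (G j) p₁ p₃ p₄) where
    private
      instance
        p₃≢0 : NonZero p₃
        p₃≢0 = prime⇒nonZero p₃-prime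
        p₄≢0 : NonZero p₄
        p₄≢0 = prime⇒nonZero p₄-prime

      torsionFree : ∀ j → TorsionFree (G j)
      torsionFree j = proj₁ (K̂₂-G j)

    -- All multipliers over the support L of g divide K; off L the component of g is 0 and ε
    -- is a witness. Testing k j ∣ K instead of j ∈ L avoids decidable equality on I.
    witness-⨁ : ∀ g → InPω (⨁ I G) p₁ g → Σ ℕ λ k → Witness (⨁ I G) p₃ p₄ (suc k) g
    witness-⨁ g@(f , L , f-supp) g∈ =
      pred K , ≡.subst (λ k → Witness (⨁ I G) p₃ p₄ k g) (≡.sym (suc-pred K))
                 (Witness-⨁ {k = K} {g} torsionFree L w w-supp)
      where
      witnessⱼ : ∀ j → Σ ℕ λ k → Witness (G j) p₃ p₄ (suc k) (f j)
      witnessⱼ j = proj₂ (proj₂ (K̂₂-G j)) (f j) (InPω-proj {x = g} g∈ j)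
      k : I → ℕ
      k j = suc (proj₁ (witnessⱼ j))
      K : ℕ
      K = product (map k L)
      instance
        K≢0 : NonZero K
        K≢0 = product≢0 (map⁺ (universal (λ _ → _) L))
      rescale : ∀ j → Dec (k j ∣ K) → Witness (G j) p₃ p₄ K (f j)
      rescale j (yes (divides m K≡mk)) =
        ≡.subst (λ k → Witness (G j) p₃ p₄ k (f j)) (≡.sym K≡mk)
          (Witness-* (G j) {k = k j} m (proj₂ (witnessⱼ j)))
      rescale j (no k∤K) =
        Witness-ε (G j) {k = K} (f-supp j (k∤K ∘ ∈⇒∣product ∘ ∈-map⁺ k))
      w : ∀ j → Witness (G j) p₃ p₄ K (f j)
      w j = rescale j (k j ∣? K)
      w-supp : ∀ j → ¬ j ∈ L → G._≈_ j (proj₁ (w j)) (G.ε j)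
      w-supp j j∉L = K̂₂-witness-of-ε≈ε (G j) {k = K} (K̂₂-G j) (f-supp j j∉L) (w j)

    K̂₂-⨁ : K̂₂ (⨁ I G) p₁ p₃ p₄
    K̂₂-⨁ = torsionFree-⨁ torsionFree , unique , witness-⨁
      where
      unique : ∀ g → InPω (⨁ I G) p₁ g →
               ∀ z z′ → InPω (⨁ I G) p₃ z → InPω (⨁ I G) p₃ z′ →
               InPω (⨁ I G) p₄ (g S.∙ z) → InPω (⨁ I G) p₄ (g S.∙ z′) → z S.≈ z′
      unique g g∈ z z′ z∈ z′∈ g∙z∈ g∙z′∈ j =
        proj₁ (proj₂ (K̂₂-G j)) (proj₁ g j) (InPω-proj {x = g} g∈ j)
          (proj₁ z j) (proj₁ z′ j)
          (InPω-proj {x = z} z∈ j) (InPω-proj {x = z′} z′∈ j)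
          (InPω-proj {x = g S.∙ z} g∙z∈ j) (InPω-proj {x = g S.∙ z′} g∙z′∈ j)

↧ₙ-+ : ∀ r s → ↧ₙ (r ℚ.+ s) ≡ ↧ₙ r ℕ.* ↧ₙ s
↧ₙ-+ (mkℚᵘ _ _) (mkℚᵘ _ _) = refl

↧ₙ-neg : ∀ r → ↧ₙ (ℚ.- r) ≡ ↧ₙ r
↧ₙ-neg (mkℚᵘ _ _) = refl

module Localisation (q : ℕ) where
  Carrier : Set
  Carrier = Σ ℚᵘ λ r → Σ ℕ λ e → ↧ₙ r ≡ q ^ e

  _+_ : Carrier → Carrier → Carrier
  (r , e , ↧r≡q^e) + (s , f , ↧s≡q^f) =
    r ℚ.+ s , e ℕ.+ f ,
    ≡.trans (↧ₙ-+ r s)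
      (≡.trans (≡.cong₂ ℕ._*_ ↧r≡q^e ↧s≡q^f) (≡.sym (^-distribˡ-+-* q e f)))

  -_ : Carrier → Carrier
  - (r , e , ↧r≡q^e) = ℚ.- r , e , ≡.trans (↧ₙ-neg r) ↧r≡q^e

  0# : Carrier
  0# = ℚ.0ℚᵘ , 0 , refl

  rawGroup : RawGroup 0ℓ 0ℓ
  rawGroup = record { _≈_ = _≃_ on proj₁ ; _∙_ = _+_ ; ε = 0# ; _⁻¹ = -_ }

  isAbelianGroup : IsAbelianGroup (_≃_ on proj₁) _+_ 0# -_
  isAbelianGroup = GroupMonomorphism.isAbelianGroup embedding ℚ.+-0-isAbelianGroup
    where
    embedding : IsGroupMonomorphism rawGroup ℚ.+-0-rawGroup proj₁
    embedding = record
      { isGroupHomomorphism = record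
        { isMonoidHomomorphism = record
          { isMagmaHomomorphism = record
            { isRelHomomorphism = record { cong = id }
            ; homo = λ _ _ → ℚ.≃-refl
            }
          ; ε-homo = ℚ.≃-refl
          }
        ; ⁻¹-homo = λ _ → ℚ.≃-refl
        }
      ; injective = id
      }

ℤ[1/_] : ℕ → AbelianGroup 0ℓ 0ℓ
ℤ[1/ q ] = record { isAbelianGroup = Localisation.isAbelianGroup q }

module ℤ[1/q] {q : ℕ} where
  open AbelianGroup ℤ[1/ q ] using (Carrier; _≈_; ε; monoid)
  open MonoidMult monoid using () renaming (_×_ to _·_)

  ·-scales-numerator : ∀ n x →
    proj₁ (n · x) ≃ mkℚᵘ (+ n ℤ.* ↥ proj₁ x) (ℚᵘ.denominator-1 (proj₁ x))
  ·-scales-numerator zero    (mkℚᵘ a d , _) = *≡* refl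
  ·-scales-numerator (suc n) x@(r@(mkℚᵘ a d) , _) =
    ℚ.≃-trans (ℚ.+-congʳ r (·-scales-numerator n x)) (*≡* (lemma a (+ n) (+ suc d)))
    where
    lemma : ∀ (a n D : ℤ) →
            (a ℤ.* D ℤ.+ (n ℤ.* a) ℤ.* D) ℤ.* D ≡ ((+ 1 ℤ.+ n) ℤ.* a) ℤ.* (D ℤ.* D)
    lemma = solve-∀

  ·≈⇒∣ : ∀ n {x} y → n · y ≈ x → n ∣ ∣ ↥ proj₁ x ∣ ℕ.* q ^ proj₁ (proj₂ y)
  ·≈⇒∣ n {r , _} y@(s , f , ↧s≡q^f) n·y≈x =
    ∣-trans (∣-trans (m∣m*n ∣ ↥ s ∣) (m∣m*n (↧ₙ r))) (∣-reflexive (begin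
      n ℕ.* ∣ ↥ s ∣ ℕ.* ↧ₙ r       ≡⟨ ≡.cong (ℕ._* ↧ₙ r) (ℤ.abs-* (+ n) (↥ s)) ⟨
      ∣ + n ℤ.* ↥ s ∣ ℕ.* ↧ₙ r     ≡⟨ ℤ.abs-* (+ n ℤ.* ↥ s) (↧ r) ⟨
      ∣ (+ n ℤ.* ↥ s) ℤ.* ↧ r ∣    ≡⟨ ≡.cong ∣_∣ cross ⟩
      ∣ ↥ r ℤ.* ↧ s ∣              ≡⟨ ℤ.abs-* (↥ r) (↧ s) ⟩
      ∣ ↥ r ∣ ℕ.* ↧ₙ s             ≡⟨ ≡.cong (∣ ↥ r ∣ ℕ.*_) ↧s≡q^f ⟩
      ∣ ↥ r ∣ ℕ.* q ^ f            ∎))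
    where
    open ≡.≡-Reasoning
    cross : (+ n ℤ.* ↥ s) ℤ.* ↧ r ≡ ↥ r ℤ.* ↧ s
    cross = ℚ.drop-*≡* (ℚ.≃-trans (ℚ.≃-sym (·-scales-numerator n y)) n·y≈x)

  torsionFree : TorsionFree ℤ[1/ q ]
  torsionFree n x [1+n]·x≈0
    with ℤ.i*j≡0⇒i≡0∨j≡0 (+ suc n)
           (ℚ.p≃0⇒↥p≡0 _ (ℚ.≃-trans (ℚ.≃-sym (·-scales-numerator (suc n) x)) [1+n]·x≈0))
  ... | inj₂ ↥x≡0 = ℚ.↥p≡0⇒p≃0 _ ↥x≡0

  divisible : .{{_ : NonZero q}} → ∀ x → InPω ℤ[1/ q ] q x
  divisible (r , e , ↧r≡q^e) n = y , ℚ.≃-trans (·-scales-numerator (q ^ n) y) (*≡* cross)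
    where
    d : ℕ
    d = q ^ (e ℕ.+ n)
    instance
      d≢0 : NonZero d
      d≢0 = m^n≢0 q (e ℕ.+ n)
    a : ℤ
    a = ↥ r
    y : Carrier
    y = a ℚ./ d , e ℕ.+ n , ≡.cong ∣_∣ (ℚ.↧[n/d]≡d a d)
    lemma : ∀ (Q a E : ℤ) → (Q ℤ.* a) ℤ.* E ≡ a ℤ.* (E ℤ.* Q)
    lemma = solve-∀
    open ≡.≡-Reasoning
    cross : (+ (q ^ n) ℤ.* ↥ proj₁ y) ℤ.* ↧ r ≡ a ℤ.* ↧ proj₁ y
    cross = begin
      (+ (q ^ n) ℤ.* ↥ proj₁ y) ℤ.* ↧ r  ≡⟨ ≡.cong₂ (λ u v → (+ (q ^ n) ℤ.* u) ℤ.* + v)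
                                              (ℚ.↥[n/d]≡n a d) ↧r≡q^e ⟩
      (+ (q ^ n) ℤ.* a) ℤ.* + (q ^ e)    ≡⟨ lemma (+ (q ^ n)) a (+ (q ^ e)) ⟩
      a ℤ.* (+ (q ^ e) ℤ.* + (q ^ n))    ≡⟨ ≡.cong (a ℤ.*_) (ℤ.pos-* (q ^ e) (q ^ n)) ⟨
      a ℤ.* + (q ^ e ℕ.* q ^ n)          ≡⟨ ≡.cong (λ m → a ℤ.* + m) (^-distribˡ-+-* q e n) ⟨
      a ℤ.* + d                          ≡⟨ ≡.cong (a ℤ.*_) (ℚ.↧[n/d]≡d a d) ⟨
      a ℤ.* ↧ proj₁ y                    ∎

  -- Take m = |numerator of x|: then p ^ m divides m, which forces m = 0.
  trivialPω : ∀ {p} → Prime p → ¬ p ∣ q → TrivialPω ℤ[1/ q ] p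
  trivialPω {p} p-prime p∤q x x∈ = ℚ.↥p≡0⇒p≃0 _ (ℤ.∣i∣≡0⇒i≡0 (m^n∣n⇒n≡0 p m p^m∣m))
    where
    instance
      p-nonTrivial : NonTrivial p
      p-nonTrivial = prime⇒nonTrivial p-prime
    m : ℕ
    m = ∣ ↥ proj₁ x ∣
    y : Carrier
    y = proj₁ (x∈ m)
    p^m∣m : p ^ m ∣ m
    p^m∣m = p^m∣a*n⇒p^m∣a p-prime (∤⇒∤^ p-prime p∤q (proj₁ (proj₂ y))) m m
              (·≈⇒∣ (p ^ m) {x} y (proj₂ (x∈ m)))

  one : Carrier
  one = ℚ.1ℚᵘ , 0 , refl

  one≉0 : ¬ one ≈ ε
  one≉0 1≃0 = ℚ.0≄1 (ℚ.≃-sym 1≃0)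

summand : ℕ → Bool → AbelianGroup 0ℓ 0ℓ
summand p₁ true  = ℤ[1/ p₁ ]
summand p₁ false = ℤ[1/ 1 ]

module _ {p₁ p₃ p₄ : ℕ} (p₁-prime : Prime p₁) (p₃-prime : Prime p₃) (p₄-prime : Prime p₄)
         (p₁≢p₃ : p₁ ≢ p₃) (p₁≢p₄ : p₁ ≢ p₄) where

  private
    instance
      p₁≢0 : NonZero p₁
      p₁≢0 = prime⇒nonZero p₁-prime

    module S = AbelianGroup (⨁ Bool (summand p₁))

    pair : AbelianGroup.Carrier ℤ[1/ p₁ ] → AbelianGroup.Carrier ℤ[1/ 1 ] → S.Carrier
    pair a b = (λ { true → a ; false → b }) , true ∷ false ∷ [] ,
               λ { true  j∉ → ⊥-elim (j∉ (here refl))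
                 ; false j∉ → ⊥-elim (j∉ (there (here refl))) }

    ∤1 : ∀ {p} → Prime p → ¬ p ∣ 1
    ∤1 p-prime p∣1 = ¬prime[1] (≡.subst Prime (∣1⇒≡1 p∣1) p-prime)

    ∤p₁ : ∀ {p} → Prime p → p ≢ p₁ → ¬ p ∣ p₁
    ∤p₁ p-prime p≢p₁ p∣p₁ with prime⇒irreducible p₁-prime p∣p₁
    ... | inj₁ p≡1  = ¬prime[1] (≡.subst Prime p≡1 p-prime)
    ... | inj₂ p≡p₁ = p≢p₁ p≡p₁

  summand-torsionFree : ∀ j → TorsionFree (summand p₁ j)
  summand-torsionFree true  = ℤ[1/q].torsionFree
  summand-torsionFree false = ℤ[1/q].torsionFree

  summand-trivialPω : ∀ {p} → Prime p → p ≢ p₁ → ∀ j → TrivialPω (summand p₁ j) p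
  summand-trivialPω p-prime p≢p₁ true  = ℤ[1/q].trivialPω p-prime (∤p₁ p-prime p≢p₁)
  summand-trivialPω p-prime _    false = ℤ[1/q].trivialPω p-prime (∤1 p-prime)

  summand-K̂ : ∀ j → K̂ (summand p₁ j) p₁ p₃ p₄
  summand-K̂ true  = inj₁ (ℤ[1/q].torsionFree , ℤ[1/q].divisible ,
                          λ p p-prime p≢p₁ → summand-trivialPω p-prime p≢p₁ true)
  summand-K̂ false = inj₂ (trivialPω⇒K̂₂ (summand p₁ false) ℤ[1/q].torsionFree
                            (ℤ[1/q].trivialPω p₁-prime (∤1 p₁-prime))
                            (summand-trivialPω p₄-prime (p₁≢p₄ ∘ ≡.sym) false))

  ⨁summand-¬K̂₁ : ¬ K̂₁ (⨁ Bool (summand p₁)) p₁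
  ⨁summand-¬K̂₁ (_ , divisible , _) =
    ℤ[1/q].one≉0 {1} (ℤ[1/q].trivialPω p₁-prime (∤1 p₁-prime) ℤ[1/q].one
      (InPω-proj (summand p₁) {x = x} (divisible x) false))
    where
    x : S.Carrier
    x = pair (AbelianGroup.ε ℤ[1/ p₁ ]) ℤ[1/q].one

  ⨁summand-¬K̂₂ : ¬ K̂₂ (⨁ Bool (summand p₁)) p₁ p₃ p₄
  ⨁summand-¬K̂₂ =
    ¬K̂₂ (⨁ Bool (summand p₁)) {g = g} g∈ (λ g≈ε → ℤ[1/q].one≉0 {p₁} (g≈ε true))
      (trivialPω-⨁ (summand p₁) (summand-trivialPω p₃-prime (p₁≢p₃ ∘ ≡.sym)))
      (trivialPω-⨁ (summand p₁) (summand-trivialPω p₄-prime (p₁≢p₄ ∘ ≡.sym)))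
    where
    g : S.Carrier
    g = pair ℤ[1/q].one (AbelianGroup.ε ℤ[1/ 1 ])
    g∈ : InPω (⨁ Bool (summand p₁)) p₁ g
    g∈ = InPω-⨁ (summand p₁) {x = g} summand-torsionFree
           λ { true → ℤ[1/q].divisible ℤ[1/q].one ; false → InPω-ε ℤ[1/ 1 ] }

  ⨁summand-¬K̂ : ¬ K̂ (⨁ Bool (summand p₁)) p₁ p₃ p₄
  ⨁summand-¬K̂ (inj₁ K̂₁-⨁summand) = ⨁summand-¬K̂₁ K̂₁-⨁summand
  ⨁summand-¬K̂ (inj₂ K̂₂-⨁summand) = ⨁summand-¬K̂₂ K̂₂-⨁summand

proposition3p5 :
    {i c ℓ : Level} (p₁ p₃ p₄ : ℕ) → Prime p₁ → Prime p₃ → Prime p₄ →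
    ¬ (p₁ ≡ p₃) → ¬ (p₁ ≡ p₄) → ¬ (p₃ ≡ p₄) →
    -- (1) \hat K_1 and \hat K_2 are closed under external direct sums
    ((∀ (I : Set i) (G : I → AbelianGroup c ℓ) →
        (∀ j → K̂₁ (G j) p₁) → K̂₁ (⨁ I G) p₁)
     × (∀ (I : Set i) (G : I → AbelianGroup c ℓ) →
        (∀ j → K̂₂ (G j) p₁ p₃ p₄) → K̂₂ (⨁ I G) p₁ p₃ p₄))
    -- (2) \hat K is not closed under direct sums
    × (Σ Set λ I → Σ (I → AbelianGroup 0ℓ 0ℓ) λ G →
        (∀ j → K̂ (G j) p₁ p₃ p₄) × ¬ (K̂ (⨁ I G) p₁ p₃ p₄))
proposition3p5 p₁ p₃ p₄ p₁-prime p₃-prime p₄-prime p₁≢p₃ p₁≢p₄ _ =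
  ((λ _ G → K̂₁-⨁ G p₁-prime) , (λ _ G → K̂₂-⨁ G p₃-prime p₄-prime)) ,
  (Bool , summand p₁ , summand-K̂ p₁-prime p₃-prime p₄-prime p₁≢p₃ p₁≢p₄ ,
   ⨁summand-¬K̂ p₁-prime p₃-prime p₄-prime p₁≢p₃ p₁≢p₄)
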